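{- Let $p$ be a prime and $k$ a positive integer with the following property: for every $k$-element subset $\mathcal{K}\subset\mathbb{Z}_p$, every element of $\mathbb{Z}_p$ is the sum of the elements of some subset of $\mathcal{K}$. Let $q=mp$ for some integer $m>1$, and let $\mathcal{B}\subset\mathbb{Z}_q$ be a set such that $|\mathcal{B}|>4k$, the elements of $\mathcal{B}$ are pairwise distinct modulo $p$, and not all elements of $\mathcal{B}$ are multiples of $m$. Then there exists a subset $\mathcal{A}\subset\mathcal{B}$ with $\Sigma(\mathcal{A})\equiv 0\pmod p$ and $\Sigma(\mathcal{A})\not\equiv 0\pmod q$.
   Context: $\mathbb{Z}_q=\mathbb{Z}/q\mathbb{Z}$; reduction modulo $p$ and being a multiple of $m$ are well defined on $\mathbb{Z}_q$ since $p\mid q$, $m\mid q$. For a finite set $\mathcal{A}$, $\Sigma(\mathcal{A})=\sum_{a\in\mathcal{A}}a$. -}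

module Defs where

open import Data.Nat using (ℕ; ∣_-_∣)
open import Data.Nat.Divisibility using (_∣_)
open import Data.Fin using (Fin; toℕ)
open import Data.Fin.Subset using (Subset; _⊆_; ∣_∣)
open import Data.Vec using (sum; tabulate; lookup)
open import Data.Bool using (if_then_else_)
open import Data.Product using (Σ; _×_)
open import Relation.Binary.PropositionalEquality using (_≡_)

-- ℤ_n is modelled as Fin n (canonical representatives 0..n-1);
-- a subset of ℤ_n is a Data.Fin.Subset n.

-- Σ(S): the sum of the representatives of the elements of S, as a natural
-- number.  Its residue modulo n is the sum Σ(S) computed in ℤ_n.
Σℕ : ∀ {n} → Subset n → ℕ
Σℕ {n} S = sum (tabulate λ (i : Fin n) → if lookup S i then toℕ i else 0)

_≡_[mod_] : ℕ → ℕ → ℕ → Set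
a ≡ b [mod n ] = n ∣ ∣ a - b ∣

AllSubsetSums : ℕ → ℕ → Set
AllSubsetSums p k =
  (K : Subset p) → ∣ K ∣ ≡ k →
  (x : Fin p) → Σ (Subset p) λ S → S ⊆ K × (Σℕ S ≡ toℕ x [mod p ])

-- Choose b₀ ∈ B with m ∤ b₀ and three pairwise disjoint k-subsets L₁, L₂, L₃ of B ∖ {b₀}.
-- Reduction mod p is injective on B, so each Lᵢ maps onto a k-subset of ℤ_p and the
-- hypothesis on (p, k) yields, for every x ∈ ℤ_p, a subset Sᵢ(x) ⊆ Lᵢ with Σ Sᵢ(x) ≡ x (mod p).
-- Put Aᵢ(x) = Σ Sᵢ(x). The sets S₁(0), S₁(x) ∪ S₂(y) ∪ S₃(z) with x + y + z = 0, and
-- {b₀} ∪ S₁(−b₀) all have sum ≡ 0 (mod p). If all of them also had sum ≡ 0 (mod q), comparing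
-- the triples (x, y, z) and (x + y, 0, z) would make A₁ additive modulo q; then
-- p · A₁(x) ≡ A₁(0) ≡ 0 (mod mp), so m ∣ A₁(−b₀), and the last set gives m ∣ b₀.
module Submission where

open import Defs
open import Data.Bool using (true; false; if_then_else_)
open import Data.Empty using (⊥-elim)
open import Data.Fin as Fin using (Fin; toℕ)
open import Data.Fin.Properties using (toℕ-fromℕ<; suc-injective; 0≢1+n; ∀-cons; ¬∀⟶∃¬)
open import Data.Fin.Subset
  using (Subset; _∈_; _∉_; _⊆_; _∩_; _∪_; _─_; ⊥; ⁅_⁆; ∣_∣)
open import Data.Fin.Subset.Properties
  using (_∈?_; ⊆-refl; ⊆-trans; ⊆-antisym; ⊥⊆; ∉⊥; ∣⊥∣≡0; ∣⁅x⁆∣≡1; x∈⁅x⁆; x∈⁅y⁆⇒x≡y;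
         p∩q⊆p; x∈p∩q⁺; x∈p∩q⁻; x∈p∪q⁺; x∈p∪q⁻; p─q⊆p)
open import Data.Nat as ℕ
  using (ℕ; zero; suc; pred; _+_; _*_; _/_; _%_; _≤_; _<_; z≤n; s≤s; z<s; ∣_-_∣; _≟_;
         NonZero; >-nonZero)
open import Data.Nat.DivMod
  using (_mod_; %-distribˡ-+; %-remove-+ʳ; m≡m%n+[m/n]*n; m%n<n; m%n%n≡m%n; m*n%n≡0)
open import Data.Nat.Divisibility
  using (_∣_; _∣?_; divides; _∣0; ∣-trans; m∣m*n; *-cancelˡ-∣; m%n≡0⇒n∣m; n∣m⇒m%n≡0; ∣m+n∣m⇒∣n)
open import Data.Nat.Primality using (Prime; prime⇒nonZero)
open import Data.Nat.Properties
  using (+-commutativeSemigroup; +-assoc; +-comm; +-identityʳ; +-suc; *-comm; m*n≢0; suc-pred;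
         ≤-total; ≤-trans; ≤-reflexive; ≤-pred; <-trans; n≤1+n; +-monoʳ-≤; +-cancelʳ-≤; m+n≤o⇒m≤o; m+[n∸m]≡n; ∣-∣-comm;
         m≤n⇒∣m-n∣≡n∸m; ∣m+n-m+o∣≡∣n-o∣; *-distribʳ-∣-∣; module ≤-Reasoning)
open import Algebra.Properties.CommutativeSemigroup +-commutativeSemigroup using (x∙yz≈y∙xz)
open import Data.Product using (Σ; ∃; _×_; _,_; proj₁; proj₂)
open import Data.Sum as Sum using (_⊎_; inj₁; inj₂; [_,_]; [_,_]′)
open import Data.Vec using ([]; _∷_; here; there; sum; tabulate; lookup)
open import Data.Vec.Properties using (lookup∘tabulate; []=⇒lookup; lookup⇒[]=)
open import Function using (_∘_; _∘′_)
open import Relation.Binary.PropositionalEquality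
  using (_≡_; _≢_; refl; sym; trans; cong; cong₂; subst; subst₂; module ≡-Reasoning)
open import Relation.Nullary using (¬_; Dec; yes; no)
open import Relation.Nullary.Decidable using (decidable-stable; _→-dec_)

private variable n n′ : ℕ

0%n≡0 : ∀ d .{{_ : NonZero d}} → 0 % d ≡ 0
0%n≡0 d = n∣m⇒m%n≡0 0 d (d ∣0)

module _ (d : ℕ) .{{_ : NonZero d}} where

  +-cong-mod : ∀ {a a′ b b′} → a % d ≡ a′ % d → b % d ≡ b′ % d → (a + b) % d ≡ (a′ + b′) % d
  +-cong-mod {a} {a′} {b} {b′} a≡a′ b≡b′ = begin
    (a + b) % d            ≡⟨ %-distribˡ-+ a b d ⟩
    (a % d + b % d) % d    ≡⟨ cong₂ (λ u v → (u + v) % d) a≡a′ b≡b′ ⟩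
    (a′ % d + b′ % d) % d  ≡⟨ %-distribˡ-+ a′ b′ d ⟨
    (a′ + b′) % d          ∎
    where open ≡-Reasoning

  %≡%⇒≡[mod] : ∀ a b → a % d ≡ b % d → a ≡ b [mod d ]
  %≡%⇒≡[mod] a b a≡b = divides ∣ a / d - b / d ∣ (begin
    ∣ a - b ∣                                  ≡⟨ cong₂ ∣_-_∣ (m≡m%n+[m/n]*n a d) (m≡m%n+[m/n]*n b d) ⟩
    ∣ a % d + a / d * d - b % d + b / d * d ∣  ≡⟨ cong (λ r → ∣ r + a / d * d - b % d + b / d * d ∣) a≡b ⟩
    ∣ b % d + a / d * d - b % d + b / d * d ∣  ≡⟨ ∣m+n-m+o∣≡∣n-o∣ (b % d) _ _ ⟩
    ∣ a / d * d - b / d * d ∣                  ≡⟨ *-distribʳ-∣-∣ d (a / d) (b / d) ⟨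
    ∣ a / d - b / d ∣ * d                      ∎)
    where open ≡-Reasoning

  ≡[mod]⇒%≡% : ∀ a b → a ≡ b [mod d ] → a % d ≡ b % d
  ≡[mod]⇒%≡% a b d∣a-b =
    [ (λ a≤b → ≤⇒%≡% a≤b d∣a-b)
    , (λ b≤a → sym (≤⇒%≡% b≤a (subst (d ∣_) (∣-∣-comm a b) d∣a-b)))
    ]′ (≤-total a b)
    where
    ≤⇒%≡% : ∀ {a b} → a ≤ b → a ≡ b [mod d ] → a % d ≡ b % d
    ≤⇒%≡% {a} {b} a≤b d∣a-b = begin
      a % d                ≡⟨ %-remove-+ʳ a (subst (d ∣_) (m≤n⇒∣m-n∣≡n∸m a≤b) d∣a-b) ⟨
      (a + (b ℕ.∸ a)) % d  ≡⟨ cong (_% d) (m+[n∸m]≡n a≤b) ⟩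
      b % d                ∎
      where open ≡-Reasoning

  +-cancelʳ-mod : ∀ a b c → (a + c) % d ≡ (b + c) % d → a % d ≡ b % d
  +-cancelʳ-mod a b c a+c≡b+c = ≡[mod]⇒%≡% a b (subst (d ∣_) (∣m+n-m+o∣≡∣n-o∣ c a b)
    (%≡%⇒≡[mod] (c + a) (c + b) (subst₂ (λ u v → u % d ≡ v % d) (+-comm a c) (+-comm b c) a+c≡b+c)))

module _ (p : ℕ) .{{_ : NonZero p}} where

  toℕ-mod : ∀ a → toℕ (a mod p) ≡ a % p
  toℕ-mod a = toℕ-fromℕ< (m%n<n a p)

  toℕ-mod-% : ∀ a → toℕ (a mod p) % p ≡ a % p
  toℕ-mod-% a = trans (cong (_% p) (toℕ-mod a)) (m%n%n≡m%n a p)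

  toℕ-0mod : toℕ (0 mod p) ≡ 0
  toℕ-0mod = trans (toℕ-mod 0) (0%n≡0 p)

  ∃-inverse-mod : ∀ a → ∃ λ (z : Fin p) → (a + toℕ z) % p ≡ 0
  ∃-inverse-mod a = (pred p * a) mod p , (begin
    (a + toℕ ((pred p * a) mod p)) % p  ≡⟨ +-cong-mod p {a} refl (toℕ-mod-% (pred p * a)) ⟩
    (suc (pred p) * a) % p              ≡⟨ cong (λ n → (n * a) % p) (suc-pred p) ⟩
    (p * a) % p                         ≡⟨ cong (_% p) (*-comm p a) ⟩
    (a * p) % p                         ≡⟨ m*n%n≡0 a p ⟩
    0                                   ∎)
    where open ≡-Reasoning

module _ {p q : ℕ} .{{_ : NonZero p}} .{{_ : NonZero q}} (A B C : Fin p → ℕ)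
         (A-zero : A (0 mod p) % q ≡ 0)
         (zero-sum : ∀ x y z → (toℕ x + toℕ y + toℕ z) % p ≡ 0 → (A x + B y + C z) % q ≡ 0)
         where

  private
    0ₚ : Fin p
    0ₚ = 0 mod p

  -- Compare the zero-sum triples (x, y, z) and (w, 0, z), where z = −w.
  A+B≡A+B[0] : ∀ x y w → (toℕ x + toℕ y) % p ≡ toℕ w % p → (A x + B y) % q ≡ (A w + B 0ₚ) % q
  A+B≡A+B[0] x y w x+y≡w = +-cancelʳ-mod q (A x + B y) (A w + B 0ₚ) (C z)
    (trans (zero-sum x y z x+y+z≡0) (sym (zero-sum w 0ₚ z w+0+z≡0)))
    where
    z = proj₁ (∃-inverse-mod p (toℕ w))
    w+z≡0 : (toℕ w + toℕ z) % p ≡ 0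
    w+z≡0 = proj₂ (∃-inverse-mod p (toℕ w))
    x+y+z≡0 : (toℕ x + toℕ y + toℕ z) % p ≡ 0
    x+y+z≡0 = trans (+-cong-mod p x+y≡w refl) w+z≡0
    w+0+z≡0 : (toℕ w + toℕ 0ₚ + toℕ z) % p ≡ 0
    w+0+z≡0 = trans (cong (λ t → (toℕ w + t + toℕ z) % p) (toℕ-0mod p))
                    (trans (cong (λ t → (t + toℕ z) % p) (+-identityʳ (toℕ w))) w+z≡0)

  B≡A+B[0] : ∀ y → B y % q ≡ (A y + B 0ₚ) % q
  B≡A+B[0] y = begin
    (0 + B y) % q     ≡⟨ +-cong-mod q (trans (0%n≡0 q) (sym A-zero)) refl ⟩
    (A 0ₚ + B y) % q  ≡⟨ A+B≡A+B[0] 0ₚ y y (cong (λ t → (t + toℕ y) % p) (toℕ-0mod p)) ⟩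
    (A y + B 0ₚ) % q  ∎
    where open ≡-Reasoning

  A-additive : ∀ x y w → (toℕ x + toℕ y) % p ≡ toℕ w % p → (A x + A y) % q ≡ A w % q
  A-additive x y w x+y≡w = +-cancelʳ-mod q (A x + A y) (A w) (B 0ₚ) (begin
    (A x + A y + B 0ₚ) % q    ≡⟨ cong (_% q) (+-assoc (A x) (A y) (B 0ₚ)) ⟩
    (A x + (A y + B 0ₚ)) % q  ≡⟨ +-cong-mod q {A x} refl (B≡A+B[0] y) ⟨
    (A x + B y) % q           ≡⟨ A+B≡A+B[0] x y w x+y≡w ⟩
    (A w + B 0ₚ) % q          ∎)
    where open ≡-Reasoning

  A-homogeneous : ∀ n x w → (n * toℕ x) % p ≡ toℕ w % p → (n * A x) % q ≡ A w % q
  A-homogeneous zero x w 0≡w = begin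
    (0 + 0) % q         ≡⟨ +-cong-mod q A[0]≡0 A[0]≡0 ⟨
    (A 0ₚ + A 0ₚ) % q   ≡⟨ A-additive 0ₚ 0ₚ w (trans (cong (λ t → (t + t) % p) (toℕ-0mod p)) 0≡w) ⟩
    A w % q             ∎
    where
    open ≡-Reasoning
    A[0]≡0 : A 0ₚ % q ≡ 0 % q
    A[0]≡0 = trans A-zero (sym (0%n≡0 q))
  A-homogeneous (suc n) x w [1+n]x≡w = begin
    (A x + n * A x) % q  ≡⟨ +-cong-mod q {A x} refl (A-homogeneous n x nx (sym (toℕ-mod-% p (n * toℕ x)))) ⟩
    (A x + A nx) % q     ≡⟨ A-additive x nx w (trans (+-cong-mod p {toℕ x} refl (toℕ-mod-% p (n * toℕ x))) [1+n]x≡w) ⟩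
    A w % q              ∎
    where
    open ≡-Reasoning
    nx = (n * toℕ x) mod p

  q∣p*A : ∀ x → q ∣ p * A x
  q∣p*A x = m%n≡0⇒n∣m (p * A x) q (trans (A-homogeneous p x 0ₚ px≡0) A-zero)
    where
    open ≡-Reasoning
    px≡0 : (p * toℕ x) % p ≡ toℕ 0ₚ % p
    px≡0 = begin
      (p * toℕ x) % p  ≡⟨ cong (_% p) (*-comm p (toℕ x)) ⟩
      (toℕ x * p) % p  ≡⟨ m*n%n≡0 (toℕ x) p ⟩
      0                ≡⟨ 0%n≡0 p ⟨
      0 % p            ≡⟨ toℕ-mod-% p 0 ⟨
      toℕ 0ₚ % p       ∎

sumOver : Subset n → (Fin n → ℕ) → ℕ
sumOver {n} p f = sum (tabulate λ (i : Fin n) → if lookup p i then f i else 0)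

Disjoint : Subset n → Subset n → Set
Disjoint p q = ∀ {x} → x ∈ p → x ∉ q

InjectiveOn : ∀ {A : Set} → (Fin n → A) → Subset n → Set
InjectiveOn g p = ∀ {i j} → i ∈ p → j ∈ p → g i ≡ g j → i ≡ j

x∈p⇒⁅x⁆⊆p : ∀ {x} {p : Subset n} → x ∈ p → ⁅ x ⁆ ⊆ p
x∈p⇒⁅x⁆⊆p {x = x} x∈p y∈⁅x⁆ = subst (_∈ _) (sym (x∈⁅y⁆⇒x≡y x y∈⁅x⁆)) x∈p

∪-least : {p q r : Subset n} → p ⊆ r → q ⊆ r → p ∪ q ⊆ r
∪-least {p = p} {q} p⊆r q⊆r x∈p∪q = [ p⊆r , q⊆r ] (x∈p∪q⁻ p q x∈p∪q)

Disjoint-mono : {p q r s : Subset n} → r ⊆ p → s ⊆ q → Disjoint p q → Disjoint r s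
Disjoint-mono r⊆p s⊆q p∩q=∅ x∈r x∈s = p∩q=∅ (r⊆p x∈r) (s⊆q x∈s)

Disjoint-∪ : {p q r : Subset n} → Disjoint p r → Disjoint q r → Disjoint (p ∪ q) r
Disjoint-∪ {p = p} {q} p∩r=∅ q∩r=∅ x∈p∪q = [ p∩r=∅ , q∩r=∅ ] (x∈p∪q⁻ p q x∈p∪q)

Disjoint-─ : (p q : Subset n) → Disjoint q (p ─ q)
Disjoint-─ (s ∷ p) (true ∷ q) here ()
Disjoint-─ (s ∷ p) (t ∷ q) (there x∈q) (there x∈p─q) = Disjoint-─ p q x∈q x∈p─q

drop-∷-Disjoint : ∀ {s t} {p q : Subset n} → Disjoint (s ∷ p) (t ∷ q) → Disjoint p q
drop-∷-Disjoint p∩q=∅ x∈p x∈q = p∩q=∅ (there x∈p) (there x∈q)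

drop-∷-InjectiveOn : ∀ {A : Set} {g : Fin (suc n) → A} {s} {p : Subset n} →
                     InjectiveOn g (s ∷ p) → InjectiveOn (g ∘ Fin.suc) p
drop-∷-InjectiveOn inj i∈p j∈p gi≡gj = suc-injective (inj (there i∈p) (there j∈p) gi≡gj)

sumOver-⊥ : (f : Fin n → ℕ) → sumOver ⊥ f ≡ 0
sumOver-⊥ {zero} f = refl
sumOver-⊥ {suc n} f = sumOver-⊥ (f ∘ Fin.suc)

sumOver-⁅⁆ : (i : Fin n) (f : Fin n → ℕ) → sumOver ⁅ i ⁆ f ≡ f i
sumOver-⁅⁆ Fin.zero f = trans (cong (f Fin.zero +_) (sumOver-⊥ (f ∘ Fin.suc))) (+-identityʳ _)
sumOver-⁅⁆ (Fin.suc i) f = sumOver-⁅⁆ i (f ∘ Fin.suc)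

sumOver-1 : (p : Subset n) → sumOver p (λ _ → 1) ≡ ∣ p ∣
sumOver-1 [] = refl
sumOver-1 (true ∷ p) = cong suc (sumOver-1 p)
sumOver-1 (false ∷ p) = sumOver-1 p

sumOver-cong-mod : ∀ d .{{_ : NonZero d}} (p : Subset n) {f g : Fin n → ℕ} → (∀ i → f i % d ≡ g i % d) →
                   sumOver p f % d ≡ sumOver p g % d
sumOver-cong-mod d [] f≡g = refl
sumOver-cong-mod d (true ∷ p) f≡g = +-cong-mod d (f≡g Fin.zero) (sumOver-cong-mod d p (f≡g ∘ Fin.suc))
sumOver-cong-mod d (false ∷ p) f≡g = +-cong-mod d {0} refl (sumOver-cong-mod d p (f≡g ∘ Fin.suc))

sumOver-∪ : (p q : Subset n) (f : Fin n → ℕ) → Disjoint p q → sumOver (p ∪ q) f ≡ sumOver p f + sumOver q f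
sumOver-∪ [] [] f _ = refl
sumOver-∪ (true ∷ p) (true ∷ q) f p∩q=∅ = ⊥-elim (p∩q=∅ here here)
sumOver-∪ (true ∷ p) (false ∷ q) f p∩q=∅ = begin
  f₀ + sumOver (p ∪ q) f₊             ≡⟨ cong (f₀ +_) (sumOver-∪ p q f₊ (drop-∷-Disjoint p∩q=∅)) ⟩
  f₀ + (sumOver p f₊ + sumOver q f₊)  ≡⟨ +-assoc f₀ (sumOver p f₊) (sumOver q f₊) ⟨
  f₀ + sumOver p f₊ + sumOver q f₊    ∎
  where
  open ≡-Reasoning
  f₀ = f Fin.zero
  f₊ = f ∘ Fin.suc
sumOver-∪ (false ∷ p) (true ∷ q) f p∩q=∅ = begin
  f₀ + sumOver (p ∪ q) f₊             ≡⟨ cong (f₀ +_) (sumOver-∪ p q f₊ (drop-∷-Disjoint p∩q=∅)) ⟩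
  f₀ + (sumOver p f₊ + sumOver q f₊)  ≡⟨ x∙yz≈y∙xz f₀ (sumOver p f₊) (sumOver q f₊) ⟩
  sumOver p f₊ + (f₀ + sumOver q f₊)  ∎
  where
  open ≡-Reasoning
  f₀ = f Fin.zero
  f₊ = f ∘ Fin.suc
sumOver-∪ (false ∷ p) (false ∷ q) f p∩q=∅ = sumOver-∪ p q (f ∘ Fin.suc) (drop-∷-Disjoint p∩q=∅)

image : (Fin n → Fin n′) → Subset n → Subset n′
image g [] = ⊥
image g (true ∷ p) = ⁅ g Fin.zero ⁆ ∪ image (g ∘ Fin.suc) p
image g (false ∷ p) = image (g ∘ Fin.suc) p

preimage : (Fin n → Fin n′) → Subset n′ → Subset n
preimage g q = tabulate (λ i → lookup q (g i))

∈-image⁺ : (g : Fin n → Fin n′) {p : Subset n} {i : Fin n} → i ∈ p → g i ∈ image g p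
∈-image⁺ g {true ∷ p} here = x∈p∪q⁺ (inj₁ (x∈⁅x⁆ (g Fin.zero)))
∈-image⁺ g {true ∷ p} (there i∈p) = x∈p∪q⁺ (inj₂ (∈-image⁺ (g ∘ Fin.suc) i∈p))
∈-image⁺ g {false ∷ p} (there i∈p) = ∈-image⁺ (g ∘ Fin.suc) i∈p

∈-image⁻ : (g : Fin n → Fin n′) (p : Subset n) {y : Fin n′} → y ∈ image g p → ∃ λ i → i ∈ p × g i ≡ y
∈-image⁻ g [] y∈ = ⊥-elim (∉⊥ y∈)
∈-image⁻ g (true ∷ p) y∈ with x∈p∪q⁻ ⁅ g Fin.zero ⁆ (image (g ∘ Fin.suc) p) y∈
... | inj₁ y∈⁅g0⁆ = Fin.zero , here , sym (x∈⁅y⁆⇒x≡y _ y∈⁅g0⁆)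
... | inj₂ y∈img = let i , i∈p , gi≡y = ∈-image⁻ (g ∘ Fin.suc) p y∈img in Fin.suc i , there i∈p , gi≡y
∈-image⁻ g (false ∷ p) y∈ = let i , i∈p , gi≡y = ∈-image⁻ (g ∘ Fin.suc) p y∈ in Fin.suc i , there i∈p , gi≡y

∈-preimage⁺ : {g : Fin n → Fin n′} {q : Subset n′} {i : Fin n} → g i ∈ q → i ∈ preimage g q
∈-preimage⁺ {g = g} {q} {i} gi∈q = lookup⇒[]= i _ (trans (lookup∘tabulate _ i) ([]=⇒lookup gi∈q))

∈-preimage⁻ : {g : Fin n → Fin n′} {q : Subset n′} {i : Fin n} → i ∈ preimage g q → g i ∈ q
∈-preimage⁻ {g = g} {q} {i} i∈ = lookup⇒[]= (g i) q (trans (sym (lookup∘tabulate _ i)) ([]=⇒lookup i∈))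

sumOver-image : (g : Fin n → Fin n′) (p : Subset n) (f : Fin n′ → ℕ) → InjectiveOn g p →
                sumOver (image g p) f ≡ sumOver p (f ∘ g)
sumOver-image g [] f _ = sumOver-⊥ f
sumOver-image g (true ∷ p) f inj = begin
  sumOver (⁅ g Fin.zero ⁆ ∪ image (g ∘ Fin.suc) p) f        ≡⟨ sumOver-∪ _ _ f g0∉img ⟩
  sumOver ⁅ g Fin.zero ⁆ f + sumOver (image (g ∘ Fin.suc) p) f ≡⟨ cong₂ _+_ (sumOver-⁅⁆ (g Fin.zero) f)
                                                                  (sumOver-image (g ∘ Fin.suc) p f (drop-∷-InjectiveOn inj)) ⟩
  f (g Fin.zero) + sumOver p (f ∘ g ∘ Fin.suc)                  ∎
  where
  open ≡-Reasoning
  g0∉img : Disjoint ⁅ g Fin.zero ⁆ (image (g ∘ Fin.suc) p)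
  g0∉img y∈⁅g0⁆ y∈img with ∈-image⁻ (g ∘ Fin.suc) p y∈img
  ... | i , i∈p , gsi≡y = 0≢1+n (inj here (there i∈p) (sym (trans gsi≡y (x∈⁅y⁆⇒x≡y _ y∈⁅g0⁆))))
sumOver-image g (false ∷ p) f inj = sumOver-image (g ∘ Fin.suc) p f (drop-∷-InjectiveOn inj)

∣image∣ : (g : Fin n → Fin n′) (p : Subset n) → InjectiveOn g p → ∣ image g p ∣ ≡ ∣ p ∣
∣image∣ g p inj = begin
  ∣ image g p ∣                     ≡⟨ sumOver-1 (image g p) ⟨
  sumOver (image g p) (λ _ → 1)     ≡⟨ sumOver-image g p (λ _ → 1) inj ⟩
  sumOver p (λ _ → 1)               ≡⟨ sumOver-1 p ⟩
  ∣ p ∣                             ∎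
  where open ≡-Reasoning

image-preimage : (g : Fin n → Fin n′) (p : Subset n) {q : Subset n′} →
                 q ⊆ image g p → image g (p ∩ preimage g q) ≡ q
image-preimage g p {q} q⊆img = ⊆-antisym ⊆q ⊇q
  where
  ⊆q : image g (p ∩ preimage g q) ⊆ q
  ⊆q y∈ with ∈-image⁻ g (p ∩ preimage g q) y∈
  ... | i , i∈ , refl = ∈-preimage⁻ (proj₂ (x∈p∩q⁻ p _ i∈))
  ⊇q : q ⊆ image g (p ∩ preimage g q)
  ⊇q y∈q with ∈-image⁻ g p (q⊆img y∈q)
  ... | i , i∈p , refl = ∈-image⁺ g (x∈p∩q⁺ (i∈p , ∈-preimage⁺ y∈q))

first : ℕ → Subset n → Subset n
first zero p = ⊥
first (suc k) [] = []
first (suc k) (true ∷ p) = true ∷ first k p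
first (suc k) (false ∷ p) = false ∷ first (suc k) p

first-⊆ : ∀ k (p : Subset n) → first k p ⊆ p
first-⊆ zero p = ⊥⊆
first-⊆ (suc k) (true ∷ p) here = here
first-⊆ (suc k) (true ∷ p) (there x∈) = there (first-⊆ k p x∈)
first-⊆ (suc k) (false ∷ p) (there x∈) = there (first-⊆ (suc k) p x∈)

∣first∣ : ∀ k (p : Subset n) → k ≤ ∣ p ∣ → ∣ first k p ∣ ≡ k
∣first∣ {n} zero p _ = ∣⊥∣≡0 n
∣first∣ (suc k) (true ∷ p) (s≤s k≤∣p∣) = cong suc (∣first∣ k p k≤∣p∣)
∣first∣ (suc k) (false ∷ p) k<∣p∣ = ∣first∣ (suc k) p k<∣p∣

∣p∣≤∣p─q∣+∣q∣ : (p q : Subset n) → ∣ p ∣ ≤ ∣ p ─ q ∣ + ∣ q ∣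
∣p∣≤∣p─q∣+∣q∣ [] [] = z≤n
∣p∣≤∣p─q∣+∣q∣ (true ∷ p) (true ∷ q) = ≤-trans (s≤s (∣p∣≤∣p─q∣+∣q∣ p q)) (≤-reflexive (sym (+-suc _ _)))
∣p∣≤∣p─q∣+∣q∣ (false ∷ p) (true ∷ q) = ≤-trans (∣p∣≤∣p─q∣+∣q∣ p q) (+-monoʳ-≤ _ (n≤1+n _))
∣p∣≤∣p─q∣+∣q∣ (true ∷ p) (false ∷ q) = s≤s (∣p∣≤∣p─q∣+∣q∣ p q)
∣p∣≤∣p─q∣+∣q∣ (false ∷ p) (false ∷ q) = ∣p∣≤∣p─q∣+∣q∣ p q

∣p─first∣ : ∀ k {a} (p : Subset n) → k + a ≤ ∣ p ∣ → a ≤ ∣ p ─ first k p ∣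
∣p─first∣ k {a} p k+a≤∣p∣ = +-cancelʳ-≤ k a ∣ p ─ first k p ∣ (begin
  a + k                              ≡⟨ +-comm a k ⟩
  k + a                              ≤⟨ k+a≤∣p∣ ⟩
  ∣ p ∣                              ≤⟨ ∣p∣≤∣p─q∣+∣q∣ p (first k p) ⟩
  ∣ p ─ first k p ∣ + ∣ first k p ∣  ≡⟨ cong (∣ p ─ first k p ∣ +_) (∣first∣ k p (m+n≤o⇒m≤o k k+a≤∣p∣)) ⟩
  ∣ p ─ first k p ∣ + k              ∎)
  where open ≤-Reasoning

∀-⊎⇒⊎-∀ : ∀ {n} {S : Set} {Q : Fin n → Set} → (∀ i → S ⊎ Q i) → S ⊎ (∀ i → Q i)
∀-⊎⇒⊎-∀ {zero} _ = inj₂ λ ()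
∀-⊎⇒⊎-∀ {suc n} s⊎q with s⊎q Fin.zero | ∀-⊎⇒⊎-∀ (s⊎q ∘ Fin.suc)
... | inj₁ s | _ = inj₁ s
... | inj₂ _ | inj₁ s = inj₁ s
... | inj₂ q₀ | inj₂ qₛ = inj₂ (∀-cons q₀ qₛ)

∃-counterexample : ∀ {n} {P Q : Fin n → Set} → (∀ i → Dec (P i)) → (∀ i → Dec (Q i)) →
                   ¬ (∀ i → P i → Q i) → ∃ λ i → P i × ¬ Q i
∃-counterexample {n} P? Q? ¬∀ with ¬∀⟶∃¬ n _ (λ i → P? i →-dec Q? i) ¬∀
... | i , ¬[P→Q] = i , decidable-stable (P? i) (λ ¬P → ¬[P→Q] (⊥-elim ∘ ¬P)) , λ Qi → ¬[P→Q] (λ _ → Qi)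

module _ {p k m : ℕ} .{{_ : NonZero p}} .{{_ : NonZero m}} (hyp : AllSubsetSums p k) (B : Subset (m * p))
         (distinct : ∀ x y → x ∈ B → y ∈ B → x ≢ y → ¬ (toℕ x ≡ toℕ y [mod p ]))
         where

  private
    q : ℕ
    q = m * p
    instance
      q≢0 : NonZero q
      q≢0 = m*n≢0 m p

  Solution : Set
  Solution = Σ (Subset q) λ A → A ⊆ B × (Σℕ A ≡ 0 [mod p ]) × ¬ (Σℕ A ≡ 0 [mod q ])

  candidate : ∀ {A} → A ⊆ B → Σℕ A % p ≡ 0 → Solution ⊎ Σℕ A % q ≡ 0
  candidate {A} A⊆B ΣA≡0[p] with Σℕ A % q ≟ 0
  ... | yes ΣA≡0[q] = inj₂ ΣA≡0[q]
  ... | no ΣA≢0[q] = inj₁ (A , A⊆B , %≡%⇒≡[mod] p (Σℕ A) 0 (trans ΣA≡0[p] (sym (0%n≡0 p))) ,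
                           λ ΣA≡0 → ΣA≢0[q] (trans (≡[mod]⇒%≡% q (Σℕ A) 0 ΣA≡0) (0%n≡0 q)))

  red : Fin q → Fin p
  red i = toℕ i mod p

  red-injectiveOn : ∀ {L} → L ⊆ B → InjectiveOn red L
  red-injectiveOn L⊆B {i} {j} i∈L j∈L ri≡rj = decidable-stable (i Fin.≟ j) λ i≢j →
    distinct i j (L⊆B i∈L) (L⊆B j∈L) i≢j (%≡%⇒≡[mod] p (toℕ i) (toℕ j) (begin
      toℕ i % p    ≡⟨ toℕ-mod p (toℕ i) ⟨
      toℕ (red i)  ≡⟨ cong toℕ ri≡rj ⟩
      toℕ (red j)  ≡⟨ toℕ-mod p (toℕ j) ⟩
      toℕ j % p    ∎))
    where open ≡-Reasoning

  subsetSum : ∀ {L} → L ⊆ B → ∣ L ∣ ≡ k → (x : Fin p) → ∃ λ S → S ⊆ L × Σℕ S % p ≡ toℕ x % p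
  subsetSum {L} L⊆B ∣L∣≡k x with hyp (image red L) (trans (∣image∣ red L (red-injectiveOn L⊆B)) ∣L∣≡k) x
  ... | T , T⊆img , ΣT≡x = S , p∩q⊆p L _ , (begin
      Σℕ S % p                   ≡⟨ sumOver-cong-mod p S (λ i → sym (toℕ-mod-% p (toℕ i))) ⟩
      sumOver S (toℕ ∘ red) % p  ≡⟨ cong (_% p) (sumOver-image red S toℕ (red-injectiveOn (L⊆B ∘′ p∩q⊆p L _))) ⟨
      Σℕ (image red S) % p       ≡⟨ cong (λ U → Σℕ U % p) (image-preimage red L T⊆img) ⟩
      Σℕ T % p                   ≡⟨ ≡[mod]⇒%≡% p _ _ ΣT≡x ⟩
      toℕ x % p                  ∎)
    where
    open ≡-Reasoning
    S = L ∩ preimage red T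

  record SubsetSums (L : Subset q) : Set where
    field
      S : Fin p → Subset q
      S⊆L : ∀ x → S x ⊆ L
      ΣS≡x : ∀ x → Σℕ (S x) % p ≡ toℕ x % p

  subsetSums : ∀ {L} → L ⊆ B → ∣ L ∣ ≡ k → SubsetSums L
  subsetSums L⊆B ∣L∣≡k = record
    { S = λ x → proj₁ (subsetSum L⊆B ∣L∣≡k x)
    ; S⊆L = λ x → proj₁ (proj₂ (subsetSum L⊆B ∣L∣≡k x))
    ; ΣS≡x = λ x → proj₂ (proj₂ (subsetSum L⊆B ∣L∣≡k x))
    }

  module _ (large : 4 * k < ∣ B ∣) (b₀ : Fin q) (b₀∈B : b₀ ∈ B) (m∤b₀ : ¬ m ∣ toℕ b₀) where

    private
      B₀ B₁ B₂ L₁ L₂ L₃ : Subset q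
      B₀ = B ─ ⁅ b₀ ⁆
      L₁ = first k B₀
      B₁ = B₀ ─ L₁
      L₂ = first k B₁
      B₂ = B₁ ─ L₂
      L₃ = first k B₂

      4k≤∣B₀∣ : k + (k + (k + (k + 0))) ≤ ∣ B₀ ∣
      4k≤∣B₀∣ = ≤-pred (begin
        suc (4 * k)          ≤⟨ large ⟩
        ∣ B ∣                ≤⟨ ∣p∣≤∣p─q∣+∣q∣ B ⁅ b₀ ⁆ ⟩
        ∣ B₀ ∣ + ∣ ⁅ b₀ ⁆ ∣  ≡⟨ cong (∣ B₀ ∣ +_) (∣⁅x⁆∣≡1 b₀) ⟩
        ∣ B₀ ∣ + 1           ≡⟨ +-comm ∣ B₀ ∣ 1 ⟩
        suc ∣ B₀ ∣           ∎)
        where open ≤-Reasoning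
      3k≤∣B₁∣ : k + (k + (k + 0)) ≤ ∣ B₁ ∣
      3k≤∣B₁∣ = ∣p─first∣ k B₀ 4k≤∣B₀∣
      2k≤∣B₂∣ : k + (k + 0) ≤ ∣ B₂ ∣
      2k≤∣B₂∣ = ∣p─first∣ k B₁ 3k≤∣B₁∣

      B₀⊆B : B₀ ⊆ B
      B₀⊆B = p─q⊆p B ⁅ b₀ ⁆
      B₁⊆B₀ : B₁ ⊆ B₀
      B₁⊆B₀ = p─q⊆p B₀ L₁
      B₂⊆B₁ : B₂ ⊆ B₁
      B₂⊆B₁ = p─q⊆p B₁ L₂

      L₁⊆B : L₁ ⊆ B
      L₁⊆B = ⊆-trans (first-⊆ k B₀) B₀⊆B
      L₂⊆B : L₂ ⊆ B
      L₂⊆B = ⊆-trans (first-⊆ k B₁) (⊆-trans B₁⊆B₀ B₀⊆B)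
      L₃⊆B : L₃ ⊆ B
      L₃⊆B = ⊆-trans (first-⊆ k B₂) (⊆-trans B₂⊆B₁ (⊆-trans B₁⊆B₀ B₀⊆B))

      b₀∉L₁ : Disjoint ⁅ b₀ ⁆ L₁
      b₀∉L₁ = Disjoint-mono ⊆-refl (first-⊆ k B₀) (Disjoint-─ B ⁅ b₀ ⁆)
      L₁∩L₂=∅ : Disjoint L₁ L₂
      L₁∩L₂=∅ = Disjoint-mono ⊆-refl (first-⊆ k B₁) (Disjoint-─ B₀ L₁)
      L₁∩L₃=∅ : Disjoint L₁ L₃
      L₁∩L₃=∅ = Disjoint-mono ⊆-refl (⊆-trans (first-⊆ k B₂) B₂⊆B₁) (Disjoint-─ B₀ L₁)
      L₂∩L₃=∅ : Disjoint L₂ L₃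
      L₂∩L₃=∅ = Disjoint-mono ⊆-refl (first-⊆ k B₂) (Disjoint-─ B₁ L₂)

      module F₁ = SubsetSums (subsetSums L₁⊆B (∣first∣ k B₀ (m+n≤o⇒m≤o k 4k≤∣B₀∣)))
      module F₂ = SubsetSums (subsetSums L₂⊆B (∣first∣ k B₁ (m+n≤o⇒m≤o k 3k≤∣B₁∣)))
      module F₃ = SubsetSums (subsetSums L₃⊆B (∣first∣ k B₂ (m+n≤o⇒m≤o k 2k≤∣B₂∣)))

      A₁ A₂ A₃ : Fin p → ℕ
      A₁ x = Σℕ (F₁.S x)
      A₂ x = Σℕ (F₂.S x)
      A₃ x = Σℕ (F₃.S x)

    triple : ∀ x y z → Solution ⊎ ((toℕ x + toℕ y + toℕ z) % p ≡ 0 → (A₁ x + A₂ y + A₃ z) % q ≡ 0)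
    triple x y z with (toℕ x + toℕ y + toℕ z) % p ≟ 0
    ... | no x+y+z≢0 = inj₂ (⊥-elim ∘ x+y+z≢0)
    ... | yes x+y+z≡0 = Sum.map₂ (λ ΣT≡0 _ → subst (λ t → t % q ≡ 0) ΣT≡ ΣT≡0) (candidate T⊆B (begin
        Σℕ T % p                     ≡⟨ cong (_% p) ΣT≡ ⟩
        (A₁ x + A₂ y + A₃ z) % p     ≡⟨ +-cong-mod p (+-cong-mod p (F₁.ΣS≡x x) (F₂.ΣS≡x y)) (F₃.ΣS≡x z) ⟩
        (toℕ x + toℕ y + toℕ z) % p  ≡⟨ x+y+z≡0 ⟩
        0                            ∎))
      where
      open ≡-Reasoning
      T = (F₁.S x ∪ F₂.S y) ∪ F₃.S z
      T⊆B : T ⊆ B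
      T⊆B = ∪-least (∪-least (L₁⊆B ∘′ F₁.S⊆L x) (L₂⊆B ∘′ F₂.S⊆L y)) (L₃⊆B ∘′ F₃.S⊆L z)
      ΣT≡ : Σℕ T ≡ A₁ x + A₂ y + A₃ z
      ΣT≡ = trans (sumOver-∪ (F₁.S x ∪ F₂.S y) (F₃.S z) toℕ
                    (Disjoint-∪ (Disjoint-mono (F₁.S⊆L x) (F₃.S⊆L z) L₁∩L₃=∅)
                                (Disjoint-mono (F₂.S⊆L y) (F₃.S⊆L z) L₂∩L₃=∅)))
                  (cong (_+ A₃ z) (sumOver-∪ (F₁.S x) (F₂.S y) toℕ
                    (Disjoint-mono (F₁.S⊆L x) (F₂.S⊆L y) L₁∩L₂=∅)))

    private
      0ₚ : Fin p
      0ₚ = 0 mod p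
      A₁[0]≡0 : A₁ 0ₚ % p ≡ 0
      A₁[0]≡0 = trans (F₁.ΣS≡x 0ₚ) (trans (toℕ-mod-% p 0) (0%n≡0 p))

      x₀ : Fin p
      x₀ = proj₁ (∃-inverse-mod p (toℕ b₀))
      T₀ : Subset q
      T₀ = ⁅ b₀ ⁆ ∪ F₁.S x₀
      T₀⊆B : T₀ ⊆ B
      T₀⊆B = ∪-least (x∈p⇒⁅x⁆⊆p b₀∈B) (L₁⊆B ∘′ F₁.S⊆L x₀)
      ΣT₀≡ : Σℕ T₀ ≡ toℕ b₀ + A₁ x₀
      ΣT₀≡ = trans (sumOver-∪ ⁅ b₀ ⁆ (F₁.S x₀) toℕ (Disjoint-mono ⊆-refl (F₁.S⊆L x₀) b₀∉L₁))
                   (cong (_+ A₁ x₀) (sumOver-⁅⁆ b₀ toℕ))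
      ΣT₀≡0 : Σℕ T₀ % p ≡ 0
      ΣT₀≡0 = begin
        Σℕ T₀ % p              ≡⟨ cong (_% p) ΣT₀≡ ⟩
        (toℕ b₀ + A₁ x₀) % p   ≡⟨ +-cong-mod p {toℕ b₀} refl (F₁.ΣS≡x x₀) ⟩
        (toℕ b₀ + toℕ x₀) % p  ≡⟨ proj₂ (∃-inverse-mod p (toℕ b₀)) ⟩
        0                      ∎
        where open ≡-Reasoning

    solution : Solution
    solution with candidate (L₁⊆B ∘′ F₁.S⊆L 0ₚ) A₁[0]≡0
                | ∀-⊎⇒⊎-∀ (λ x → ∀-⊎⇒⊎-∀ λ y → ∀-⊎⇒⊎-∀ (triple x y))
                | candidate T₀⊆B ΣT₀≡0
    ... | inj₁ sol | _ | _ = sol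
    ... | inj₂ _ | inj₁ sol | _ = sol
    ... | inj₂ _ | inj₂ _ | inj₁ sol = sol
    ... | inj₂ A₁[0]≡0[q] | inj₂ zero-sum | inj₂ T₀≡0[q] =
      ⊥-elim (m∤b₀ (∣m+n∣m⇒∣n m∣A₁x₀+b₀ (m∣A₁ x₀)))
      where
      m∣A₁ : ∀ x → m ∣ A₁ x
      m∣A₁ x = *-cancelˡ-∣ p (subst (_∣ p * A₁ x) (*-comm m p) (q∣p*A A₁ A₂ A₃ A₁[0]≡0[q] zero-sum x))
      m∣A₁x₀+b₀ : m ∣ A₁ x₀ + toℕ b₀
      m∣A₁x₀+b₀ = ∣-trans (m∣m*n p)
        (subst (q ∣_) (trans ΣT₀≡ (+-comm (toℕ b₀) (A₁ x₀))) (m%n≡0⇒n∣m (Σℕ T₀) q T₀≡0[q]))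

proposition2p1 : (p k m : ℕ) → Prime p → 1 ≤ k → AllSubsetSums p k → 1 < m →
    (B : Subset (m * p)) →
    4 * k < ∣ B ∣ →
    (∀ x y → x ∈ B → y ∈ B → x ≢ y → ¬ (toℕ x ≡ toℕ y [mod p ])) →
    ¬ (∀ x → x ∈ B → m ∣ toℕ x) →
    Σ (Subset (m * p)) λ A → A ⊆ B × ((Σℕ A ≡ 0 [mod p ]) × ¬ (Σℕ A ≡ 0 [mod m * p ]))
proposition2p1 p k m p-prime _ hyp 1<m B large distinct not-all-divisible
  with ∃-counterexample (_∈? B) (λ x → m ∣? toℕ x) not-all-divisible
... | b₀ , b₀∈B , m∤b₀ =
  solution {m = m} {{prime⇒nonZero p-prime}} {{>-nonZero (<-trans z<s 1<m)}} hyp B distinct large b₀ b₀∈B m∤b₀
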